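{- For integers $r\ge 0$, let $F_r(X,Y)=\sum_{i=0}^{r}\sum_{j=0}^{r}\varepsilon_{ij}X^iY^j$, where the $\varepsilon_{ij}$, $0\le i,j\le r$, are independent random variables, each uniformly distributed on $\{1,-1\}$. Then \[ \lim_{r\to\infty}\mathbb{P}\big(F_r \text{ is reducible in } \mathbb{Q}[X,Y]\big)=0 . \]
   Context: A polynomial is reducible in $\mathbb{Q}[X,Y]$ if it is a product of two non-constant polynomials in $\mathbb{Q}[X,Y]$. Since all coefficients of $F_r$ are $\pm1$, this is the same as $F_r$ being a product of two non-constant polynomials in $\mathbb{Z}[X,Y]$. -}

module Defs where

open import Data.Nat as ℕ using (ℕ; zero; suc; _∸_; _<?_)
open import Data.Integer as ℤ using (ℤ; 0ℤ; 1ℤ; -1ℤ)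
open import Data.Fin using (Fin; fromℕ<)
open import Data.Vec using (Vec; lookup)
open import Data.Sign using (Sign)
open import Data.Product using (∃; ∃-syntax; _×_)
open import Data.Sum using (_⊎_)
open import Relation.Nullary using (¬_; yes; no)
open import Relation.Binary.PropositionalEquality using (_≡_)

-- A bivariate "coefficient array": (i , j) ↦ coefficient of X^i Y^j.
Coeffs : Set
Coeffs = ℕ → ℕ → ℤ

-- Finite support: such an array is a genuine polynomial in ℤ[X,Y].
FinSupp : Coeffs → Set
FinSupp p = ∃[ d ] (∀ i j → (d ℕ.< i ⊎ d ℕ.< j) → p i j ≡ 0ℤ)

sumBelow : ℕ → (ℕ → ℤ) → ℤ
sumBelow zero    f = 0ℤ
sumBelow (suc n) f = sumBelow n f ℤ.+ f n

mul : Coeffs → Coeffs → Coeffs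
mul p q i j = sumBelow (suc i) λ a → sumBelow (suc j) λ b →
                p a b ℤ.* q (i ∸ a) (j ∸ b)

NonConstant : Coeffs → Set
NonConstant p = ∃[ i ] ∃[ j ] (0 ℕ.< i ℕ.+ j × ¬ (p i j ≡ 0ℤ))

Reducible : Coeffs → Set
Reducible F = ∃[ p ] ∃[ q ]
  (FinSupp p × FinSupp q × NonConstant p × NonConstant q × (∀ i j → F i j ≡ mul p q i j))

SignMat : ℕ → Set
SignMat r = Vec (Vec Sign (suc r)) (suc r)

signToℤ : Sign → ℤ
signToℤ Sign.+ = 1ℤ
signToℤ Sign.- = -1ℤ

Fpoly : (r : ℕ) → SignMat r → Coeffs
Fpoly r ε i j with i <? suc r | j <? suc r
... | yes i< | yes j< = signToℤ (lookup (lookup ε (fromℕ< i<)) (fromℕ< j<))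
... | _      | _      = 0ℤ

-- Write a factorisation F_r = P · Q so that Q has the smaller bounding box [0,x]×[0,y]; since bounding
-- boxes add under multiplication, 1 ≤ x + y ≤ r and P lies in [0,r−x]×[0,r−y]. The signs ε are then
-- determined by x, y, Q mod 4 and one bit per coefficient of P: as F_r ≡ 1 and Q(0,0) is odd, P mod 2
-- is determined by Q mod 2, and ±1 are read off F_r ≡ P · Q mod 4. This leaves at most
-- 2^(2(x+1)(y+1) + (r−x+1)(r−y+1)) ≤ 2^((r+1)² − h) sign matrices per box, with h ≈ r/4, and the
-- (r+1)² boxes are absorbed once 2^h ≥ (n+1)(r+1)².

module Submission where

open import Defs
open import Data.Nat as ℕ using (ℕ; zero; suc; _∸_; _^_; z≤n; s≤s; _≤_; _<_)
import Data.Nat.Properties as ℕ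
open import Data.Product using (∃; ∃-syntax; ∃₂; _×_; _,_; proj₁; proj₂)
open import Data.Sum using (_⊎_; inj₁; inj₂)
open import Relation.Nullary using (¬_; yes; no; contradiction)
open import Relation.Binary.PropositionalEquality hiding ([_])

module Congruence where

  open import Data.Integer using (ℤ; +_; 0ℤ; 1ℤ; _+_; _*_; _-_; -_; _%ℕ_; _/ℕ_)
  import Data.Integer.Properties as ℤ
  open import Data.Integer.DivMod using (a≡a%ℕn+[a/ℕn]*n)
  open import Data.Integer.Divisibility.Signed
  open import Data.Integer.Tactic.RingSolver using (solve-∀)
  import Data.Nat.Divisibility as ℕ
  open import Relation.Nullary using (Dec)
  open import Relation.Nullary.Decidable using (map′)

  infix 4 _≡_[mod_]
  record _≡_[mod_] (a b : ℤ) (m : ℕ) : Set where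
    constructor congruent
    field divides-difference : + m ∣ a - b

  module _ {m : ℕ} where

    mod-reflexive : ∀ {a b} → a ≡ b → a ≡ b [mod m ]
    mod-reflexive {a} refl = congruent (divides 0ℤ (trans (ℤ.+-inverseʳ a) (sym (ℤ.*-zeroˡ (+ m)))))

    mod-refl : ∀ {a} → a ≡ a [mod m ]
    mod-refl = mod-reflexive refl

    mod-sym : ∀ {a b} → a ≡ b [mod m ] → b ≡ a [mod m ]
    mod-sym {a} {b} (congruent m∣a-b) = congruent (subst (+ m ∣_) (negate a b) (∣m⇒∣-m m∣a-b))
      where negate : ∀ a b → - (a - b) ≡ b - a
            negate = solve-∀

    mod-trans : ∀ {a b c} → a ≡ b [mod m ] → b ≡ c [mod m ] → a ≡ c [mod m ]
    mod-trans {a} {b} {c} (congruent m∣a-b) (congruent m∣b-c) =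
      congruent (subst (+ m ∣_) (telescope a b c) (∣m∣n⇒∣m+n m∣a-b m∣b-c))
      where telescope : ∀ a b c → (a - b) + (b - c) ≡ a - c
            telescope = solve-∀

    +-cong-mod : ∀ {a b c d} → a ≡ b [mod m ] → c ≡ d [mod m ] → a + c ≡ b + d [mod m ]
    +-cong-mod {a} {b} {c} {d} (congruent m∣a-b) (congruent m∣c-d) =
      congruent (subst (+ m ∣_) (regroup a b c d) (∣m∣n⇒∣m+n m∣a-b m∣c-d))
      where regroup : ∀ a b c d → (a - b) + (c - d) ≡ (a + c) - (b + d)
            regroup = solve-∀

    *-cong-mod : ∀ {a b c d} → a ≡ b [mod m ] → c ≡ d [mod m ] → a * c ≡ b * d [mod m ]
    *-cong-mod {a} {b} {c} {d} (congruent m∣a-b) (congruent m∣c-d) =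
      congruent (subst (+ m ∣_) (split a b c d) (∣m∣n⇒∣m+n (∣n⇒∣m*n a m∣c-d) (∣m⇒∣m*n d m∣a-b)))
      where split : ∀ a b c d → a * (c - d) + (a - b) * d ≡ a * c - b * d
            split = solve-∀

    +-cancelˡ-mod : ∀ {a b c d} → a ≡ b [mod m ] → a + c ≡ b + d [mod m ] → c ≡ d [mod m ]
    +-cancelˡ-mod {a} {b} {c} {d} (congruent m∣a-b) (congruent m∣ac-bd) =
      congruent (subst (+ m ∣_) (regroup a b c d) (∣m∣n⇒∣m-n m∣ac-bd m∣a-b))
      where regroup : ∀ a b c d → (a + c) - (b + d) - (a - b) ≡ c - d
            regroup = solve-∀

    %ℕ-mod : ∀ a .{{_ : ℕ.NonZero m}} → + (a %ℕ m) ≡ a [mod m ]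
    %ℕ-mod a = mod-sym (congruent (divides (a /ℕ m)
      (trans (cong (_- + (a %ℕ m)) (a≡a%ℕn+[a/ℕn]*n a m)) (cancel (+ (a %ℕ m)) (a /ℕ m) (+ m)))))
      where cancel : ∀ r q d → (r + q * d) - r ≡ q * d
            cancel = solve-∀

  infix 4 _≡?_[mod_]
  _≡?_[mod_] : ∀ a b m → Dec (a ≡ b [mod m ])
  a ≡? b [mod m ] = map′ congruent _≡_[mod_].divides-difference (+ m ∣? a - b)

  mod-∣ : ∀ {n m a b} → n ℕ.∣ m → a ≡ b [mod m ] → a ≡ b [mod n ]
  mod-∣ n∣m (congruent m∣a-b) = congruent (∣-trans (∣ᵤ⇒∣ n∣m) m∣a-b)

  *-cancelʳ-mod : ∀ {m a b q u} → q * u ≡ 1ℤ [mod m ] → a * q ≡ b * q [mod m ] → a ≡ b [mod m ]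
  *-cancelʳ-mod {m} {a} {b} {q} {u} qu≡1 aq≡bq =
    mod-trans (mod-sym (unit-inverse a)) (mod-trans (*-cong-mod aq≡bq (mod-refl {a = u})) (unit-inverse b))
    where
    unit-inverse : ∀ c → c * q * u ≡ c [mod m ]
    unit-inverse c = mod-trans (mod-reflexive (ℤ.*-assoc c q u))
                               (mod-trans (*-cong-mod (mod-refl {a = c}) qu≡1) (mod-reflexive (ℤ.*-identityʳ c)))

  *-scale-mod : ∀ k {m a b} → a ≡ b [mod m ] → + k * a ≡ + k * b [mod k ℕ.* m ]
  *-scale-mod k {m} {a} {b} (congruent m∣a-b) =
    congruent (subst₂ _∣_ (sym (ℤ.pos-* k m)) (distrib (+ k) a b) (*-monoʳ-∣ (+ k) m∣a-b))
    where distrib : ∀ k a b → k * (a - b) ≡ k * a - k * b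
          distrib = solve-∀

module Sums where

  open import Data.Integer using (ℤ; 0ℤ; _+_)
  import Data.Integer.Properties as ℤ
  open import Algebra.Properties.CommutativeSemigroup ℤ.+-commutativeSemigroup
    using () renaming (interchange to +-interchange)
  open import Function using (_∘_)
  open Congruence

  sumBelow-cong : ∀ n {f g : ℕ → ℤ} → (∀ {k} → k < n → f k ≡ g k) → sumBelow n f ≡ sumBelow n g
  sumBelow-cong zero    f≡g = refl
  sumBelow-cong (suc n) f≡g = cong₂ _+_ (sumBelow-cong n (f≡g ∘ ℕ.m<n⇒m<1+n)) (f≡g ℕ.≤-refl)

  sumBelow-cong-mod : ∀ n {m} {f g : ℕ → ℤ} → (∀ {k} → k < n → f k ≡ g k [mod m ]) →
                      sumBelow n f ≡ sumBelow n g [mod m ]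
  sumBelow-cong-mod zero    f≡g = mod-refl
  sumBelow-cong-mod (suc n) f≡g = +-cong-mod (sumBelow-cong-mod n (f≡g ∘ ℕ.m<n⇒m<1+n)) (f≡g ℕ.≤-refl)

  sumBelow-zero : ∀ n {f : ℕ → ℤ} → (∀ {k} → k < n → f k ≡ 0ℤ) → sumBelow n f ≡ 0ℤ
  sumBelow-zero zero    f≡0 = refl
  sumBelow-zero (suc n) f≡0 = cong₂ _+_ (sumBelow-zero n (f≡0 ∘ ℕ.m<n⇒m<1+n)) (f≡0 ℕ.≤-refl)

  sumBelow-single : ∀ n {f : ℕ → ℤ} {k} → k < n → (∀ {i} → i < n → i ≢ k → f i ≡ 0ℤ) →
                    sumBelow n f ≡ f k
  sumBelow-single (suc n) {f} {k} k<1+n others with k ℕ.≟ n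
  ... | yes refl = begin
    sumBelow n f + f n ≡⟨ cong (_+ f n) (sumBelow-zero n (λ i<n → others (ℕ.m<n⇒m<1+n i<n) (ℕ.<⇒≢ i<n))) ⟩
    0ℤ + f n           ≡⟨ ℤ.+-identityˡ (f n) ⟩
    f n                ∎
    where open ≡-Reasoning
  ... | no k≢n = begin
    sumBelow n f + f n ≡⟨ cong₂ _+_ (sumBelow-single n k<n (others ∘ ℕ.m<n⇒m<1+n)) (others ℕ.≤-refl (k≢n ∘ sym)) ⟩
    f k + 0ℤ           ≡⟨ ℤ.+-identityʳ (f k) ⟩
    f k                ∎
    where open ≡-Reasoning
          k<n = ℕ.≤∧≢⇒< (ℕ.≤-pred k<1+n) k≢n

  sumBelow-+ : ∀ n (f g : ℕ → ℤ) → sumBelow n (λ k → f k + g k) ≡ sumBelow n f + sumBelow n g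
  sumBelow-+ zero    f g = refl
  sumBelow-+ (suc n) f g =
    trans (cong (_+ (f n + g n)) (sumBelow-+ n f g)) (+-interchange (sumBelow n f) (sumBelow n g) (f n) (g n))

  sumBelow-swap : ∀ m n (f : ℕ → ℕ → ℤ) →
                  sumBelow m (λ a → sumBelow n (f a)) ≡ sumBelow n (λ b → sumBelow m (λ a → f a b))
  sumBelow-swap zero    n f = sym (sumBelow-zero n (λ _ → refl))
  sumBelow-swap (suc m) n f = begin
    sumBelow m (λ a → sumBelow n (f a)) + sumBelow n (f m)
      ≡⟨ cong (_+ sumBelow n (f m)) (sumBelow-swap m n f) ⟩
    sumBelow n (λ b → sumBelow m (λ a → f a b)) + sumBelow n (f m)
      ≡⟨ sumBelow-+ n _ (f m) ⟨
    sumBelow n (λ b → sumBelow (suc m) (λ a → f a b)) ∎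
    where open ≡-Reasoning

  sumBelow-head : ∀ n (f : ℕ → ℤ) → sumBelow (suc n) f ≡ f 0 + sumBelow n (f ∘ suc)
  sumBelow-head zero    f = trans (ℤ.+-identityˡ (f 0)) (sym (ℤ.+-identityʳ (f 0)))
  sumBelow-head (suc n) f = trans (cong (_+ f (suc n)) (sumBelow-head n f)) (ℤ.+-assoc (f 0) _ _)

  sumBelow-reverse : ∀ n (f : ℕ → ℤ) → sumBelow n f ≡ sumBelow n (λ k → f (n ∸ suc k))
  sumBelow-reverse zero    f = refl
  sumBelow-reverse (suc n) f = begin
    sumBelow n f + f n                        ≡⟨ cong (_+ f n) (sumBelow-reverse n f) ⟩
    sumBelow n (λ k → f (n ∸ suc k)) + f n    ≡⟨ ℤ.+-comm _ (f n) ⟩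
    f n + sumBelow n (λ k → f (n ∸ suc k))    ≡⟨ sumBelow-head n (λ k → f (n ∸ k)) ⟨
    sumBelow (suc n) (λ k → f (suc n ∸ suc k)) ∎
    where open ≡-Reasoning

module Product where

  open import Data.Integer using (ℤ; 0ℤ; 1ℤ; _*_)
  import Data.Integer.Properties as ℤ
  open Congruence
  open Sums

  mul-comm : ∀ p q i j → mul p q i j ≡ mul q p i j
  mul-comm p q i j = begin
    mul p q i j
      ≡⟨ sumBelow-reverse (suc i) _ ⟩
    sumBelow (suc i) (λ a → sumBelow (suc j) (λ b → p (i ∸ a) b * q (i ∸ (i ∸ a)) (j ∸ b)))
      ≡⟨ sumBelow-cong (suc i) (λ a<1+i → trans (sumBelow-reverse (suc j) _)
                                                 (sumBelow-cong (suc j) (reflected-term a<1+i))) ⟩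
    mul q p i j ∎
    where
    open ≡-Reasoning
    reflected-term : ∀ {a b} → a < suc i → b < suc j →
                     p (i ∸ a) (j ∸ b) * q (i ∸ (i ∸ a)) (j ∸ (j ∸ b)) ≡ q a b * p (i ∸ a) (j ∸ b)
    reflected-term {a} {b} (s≤s a≤i) (s≤s b≤j)
      rewrite ℕ.m∸[m∸n]≡n a≤i | ℕ.m∸[m∸n]≡n b≤j = ℤ.*-comm (p (i ∸ a) (j ∸ b)) (q a b)

  mul-origin : ∀ p q → mul p q 0 0 ≡ p 0 0 * q 0 0
  mul-origin p q = trans (ℤ.+-identityˡ _) (ℤ.+-identityˡ _)

  transpose : Coeffs → Coeffs
  transpose p i j = p j i

  mul-transpose : ∀ p q i j → mul (transpose p) (transpose q) i j ≡ mul p q j i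
  mul-transpose p q i j = sumBelow-swap (suc i) (suc j) (λ a b → p b a * q (j ∸ b) (i ∸ a))

  mul-cong-mod : ∀ {m p p′ q q′} → (∀ i j → p i j ≡ p′ i j [mod m ]) → (∀ i j → q i j ≡ q′ i j [mod m ]) →
                 ∀ i j → mul p q i j ≡ mul p′ q′ i j [mod m ]
  mul-cong-mod p≡p′ q≡q′ i j =
    sumBelow-cong-mod (suc i) λ {a} _ → sumBelow-cong-mod (suc j) λ {b} _ →
      *-cong-mod (p≡p′ a b) (q≡q′ (i ∸ a) (j ∸ b))

  mul-single : ∀ p q {i j a b} → a ≤ i → b ≤ j →
               (∀ {a′ b′} → a′ ≤ i → b′ ≤ j → p a′ b′ ≢ 0ℤ → q (i ∸ a′) (j ∸ b′) ≢ 0ℤ → a′ ≡ a × b′ ≡ b) →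
               mul p q i j ≡ p a b * q (i ∸ a) (j ∸ b)
  mul-single p q {i} {j} {a} {b} a≤i b≤j only =
    trans (sumBelow-single (suc i) (s≤s a≤i) λ a′< a′≢a → sumBelow-zero (suc j) λ b′< → vanish a′< b′< (inj₁ a′≢a))
          (sumBelow-single (suc j) (s≤s b≤j) λ b′< b′≢b → vanish (s≤s a≤i) b′< (inj₂ b′≢b))
    where
    vanish : ∀ {a′ b′} → a′ < suc i → b′ < suc j → a′ ≢ a ⊎ b′ ≢ b → p a′ b′ * q (i ∸ a′) (j ∸ b′) ≡ 0ℤ
    vanish {a′} {b′} (s≤s a′≤i) (s≤s b′≤j) elsewhere with p a′ b′ ℤ.≟ 0ℤ | q (i ∸ a′) (j ∸ b′) ℤ.≟ 0ℤ
    ... | yes p≡0 | _       = trans (cong (_* q (i ∸ a′) (j ∸ b′)) p≡0) (ℤ.*-zeroˡ (q (i ∸ a′) (j ∸ b′)))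
    ... | no _    | yes q≡0 = trans (cong (p a′ b′ *_) q≡0) (ℤ.*-zeroʳ (p a′ b′))
    ... | no p≢0  | no q≢0  with only a′≤i b′≤j p≢0 q≢0 | elsewhere
    ...   | refl , refl | inj₁ a≢a = contradiction refl a≢a
    ...   | refl , refl | inj₂ b≢b = contradiction refl b≢b

  module _ {m : ℕ} {p p′ q : Coeffs} {u : ℤ} (unit : q 0 0 * u ≡ 1ℤ [mod m ]) {I J : ℕ}
           (same-product : ∀ {i j} → i ≤ I → j ≤ J → mul p q i j ≡ mul p′ q i j [mod m ]) where

    private
      next-coefficient : ∀ {i j} → i ≤ I → j ≤ J →
                         (∀ {a b} → a < i → b ≤ j → p a b ≡ p′ a b [mod m ]) →
                         (∀ {b} → b < j → p i b ≡ p′ i b [mod m ]) →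
                         p i j ≡ p′ i j [mod m ]
      -- Coefficient (i, j) of p · q is p i j * q 0 0 plus terms involving only earlier coefficients of p.
      next-coefficient {i} {j} i≤I j≤J earlier-rows earlier-columns =
        *-cancelʳ-mod unit (subst₂ (λ a b → p i j * q a b ≡ p′ i j * q a b [mod m ]) (ℕ.n∸n≡0 i) (ℕ.n∸n≡0 j)
          (+-cancelˡ-mod (sumBelow-cong-mod j λ b<j → *-cong-mod (earlier-columns b<j) mod-refl)
            (+-cancelˡ-mod (sumBelow-cong-mod i λ a<i → sumBelow-cong-mod (suc j) λ b<1+j →
                              *-cong-mod (earlier-rows a<i (ℕ.≤-pred b<1+j)) mod-refl)
              (same-product i≤I j≤J))))

      agree-below : ∀ n {i j} → i ℕ.+ j < n → i ≤ I → j ≤ J → p i j ≡ p′ i j [mod m ]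
      agree-below (suc n) {i} {j} (s≤s i+j≤n) i≤I j≤J = next-coefficient i≤I j≤J
        (λ a<i b≤j → agree-below n (ℕ.<-≤-trans (ℕ.+-mono-<-≤ a<i b≤j) i+j≤n)
                                   (ℕ.≤-trans (ℕ.<⇒≤ a<i) i≤I) (ℕ.≤-trans b≤j j≤J))
        (λ b<j → agree-below n (ℕ.<-≤-trans (ℕ.+-monoʳ-< i b<j) i+j≤n) i≤I (ℕ.≤-trans (ℕ.<⇒≤ b<j) j≤J))

    mul-cancelʳ-mod : ∀ {i j} → i ≤ I → j ≤ J → p i j ≡ p′ i j [mod m ]
    mul-cancelʳ-mod {i} {j} = agree-below (suc (i ℕ.+ j)) ℕ.≤-refl

module Support where

  open import Data.Integer using (ℤ; 0ℤ; _*_)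
  import Data.Integer.Properties as ℤ
  open import Relation.Nullary.Decidable using (¬?)
  open import Relation.Unary using (Decidable)
  open import Data.Product using (swap)
  open import Data.Sum using ([_,_]′)
  open import Function using (_∘_)
  open Product

  SupportedIn : ℕ → ℕ → Coeffs → Set
  SupportedIn m n p = ∀ {i j} → p i j ≢ 0ℤ → i ≤ m × j ≤ n

  largest : ∀ {P : ℕ → Set} → Decidable P → ∀ d → (∀ {i} → P i → i ≤ d) →
            ∀ {i} → P i → ∃[ a ] P a × (∀ {i} → P i → i ≤ a)
  largest P? d bounded Pi with P? d
  ... | yes Pd = d , Pd , bounded
  largest P? zero    bounded Pi | no ¬P0 with z≤n ← bounded Pi = contradiction Pi ¬P0
  largest P? (suc d) bounded Pi | no ¬Pd =
    largest P? d (λ {j} Pj → ℕ.≤-pred (ℕ.≤∧≢⇒< (bounded Pj) λ { refl → ¬Pd Pj })) Pi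

  nonzero? : ∀ (p : Coeffs) i → Decidable (λ j → p i j ≢ 0ℤ)
  nonzero? p i j = ¬? (p i j ℤ.≟ 0ℤ)

  vanishes-outside : ∀ {m n p i j} → SupportedIn m n p → ¬ (i ≤ m × j ≤ n) → p i j ≡ 0ℤ
  vanishes-outside {p = p} {i} {j} supported outside with p i j ℤ.≟ 0ℤ
  ... | yes p≡0 = p≡0
  ... | no  p≢0 = contradiction (supported p≢0) outside

  finSupp-bounds : ∀ {p} ((d , _) : FinSupp p) → SupportedIn d d p
  finSupp-bounds {p} (d , vanishes) {i} {j} p≢0 with i ℕ.≤? d | j ℕ.≤? d
  ... | yes i≤d | yes j≤d = i≤d , j≤d
  ... | no i≰d  | _       = contradiction (vanishes i j (inj₁ (ℕ.≰⇒> i≰d))) p≢0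
  ... | yes _   | no j≰d  = contradiction (vanishes i j (inj₂ (ℕ.≰⇒> j≰d))) p≢0

  finSupp-transpose : ∀ {p} → FinSupp p → FinSupp (transpose p)
  finSupp-transpose (d , vanishes) = d , λ i j → vanishes j i ∘ Data.Sum.swap

  record LastRow (p : Coeffs) (m : ℕ) : Set where
    field
      bounds   : ∀ {i j} → p i j ≢ 0ℤ → i ≤ m
      attained : ∃[ j ] p m j ≢ 0ℤ

  private
    nonzero-row : ∀ {p} ((d , _) : FinSupp p) {i j} → p i j ≢ 0ℤ → ∃[ j ] j < suc d × p i j ≢ 0ℤ
    nonzero-row fs {j = j} p≢0 = j , s≤s (proj₂ (finSupp-bounds fs p≢0)) , p≢0

  lastRow : ∀ {p} → FinSupp p → ∀ {i j} → p i j ≢ 0ℤ → ∃ (LastRow p)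
  lastRow {p} fs@(d , _) p≢0
    with m , (j , _ , pmj≢0) , maximal ← largest (λ i → ℕ.anyUpTo? (nonzero? p i) (suc d)) d
                                                 (λ (_ , _ , p≢0) → proj₁ (finSupp-bounds fs p≢0))
                                                 (nonzero-row fs p≢0)
    = m , record { bounds = λ p≢0 → maximal (nonzero-row fs p≢0) ; attained = j , pmj≢0 }

  BoundingBox : Coeffs → ℕ → ℕ → Set
  BoundingBox p m n = LastRow p m × LastRow (transpose p) n

  boundingBox : ∀ {p} → FinSupp p → ∀ {i j} → p i j ≢ 0ℤ → ∃₂ (BoundingBox p)
  boundingBox fs p≢0 with m , row ← lastRow fs p≢0 | n , column ← lastRow (finSupp-transpose fs) p≢0
    = m , n , row , column

  boundingBox-supported : ∀ {p m n} → BoundingBox p m n → SupportedIn m n p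
  boundingBox-supported (row , column) p≢0 = LastRow.bounds row p≢0 , LastRow.bounds column p≢0

  boundingBox-nonConstant : ∀ {p m n} → BoundingBox p m n → NonConstant p → 1 ≤ m ℕ.+ n
  boundingBox-nonConstant box (i , j , 0<i+j , p≢0) =
    let (i≤m , j≤n) = boundingBox-supported box p≢0 in ℕ.≤-trans 0<i+j (ℕ.+-mono-≤ i≤m j≤n)

  m+n∸o≤n⇒m≤o : ∀ m n o → m ℕ.+ n ∸ o ≤ n → m ≤ o
  m+n∸o≤n⇒m≤o m n o le = ℕ.+-cancelʳ-≤ n m o (ℕ.≤-trans (ℕ.m≤n+m∸n (m ℕ.+ n) o) (ℕ.+-monoʳ-≤ o le))

  -- The lexicographically last nonzero terms of p and q are the only pair contributing to their exponent sum.
  mul-lastRow : ∀ {p q a b c d} → BoundingBox p a b → BoundingBox q c d → ∃[ j ] mul p q (a ℕ.+ c) j ≢ 0ℤ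
  mul-lastRow {p} {q} {a} {b} {c} {d} (p-rows , p-columns) (q-rows , q-columns) =
    corner (largest (nonzero? p a) b (LastRow.bounds p-columns) (proj₂ (LastRow.attained p-rows)))
           (largest (nonzero? q c) d (LastRow.bounds q-columns) (proj₂ (LastRow.attained q-rows)))
    where
    corner : ∃[ j₁ ] p a j₁ ≢ 0ℤ × (∀ {j} → p a j ≢ 0ℤ → j ≤ j₁) →
             ∃[ j₂ ] q c j₂ ≢ 0ℤ × (∀ {j} → q c j ≢ 0ℤ → j ≤ j₂) →
             ∃[ j ] mul p q (a ℕ.+ c) j ≢ 0ℤ
    corner (j₁ , paj₁≢0 , j₁-last) (j₂ , qcj₂≢0 , j₂-last) = j₁ ℕ.+ j₂ , λ mul≡0 →
      [ paj₁≢0 , qcj₂≢0 ]′ (ℤ.i*j≡0⇒i≡0∨j≡0 (p a j₁) (trans (sym product-at-corner) mul≡0))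
      where
      only : ∀ {a′ b′} → a′ ≤ a ℕ.+ c → b′ ≤ j₁ ℕ.+ j₂ → p a′ b′ ≢ 0ℤ →
             q (a ℕ.+ c ∸ a′) (j₁ ℕ.+ j₂ ∸ b′) ≢ 0ℤ → a′ ≡ a × b′ ≡ j₁
      only {a′} {b′} _ _ p≢0 q≢0
        with refl ← ℕ.≤-antisym (LastRow.bounds p-rows p≢0) (m+n∸o≤n⇒m≤o a c a′ (LastRow.bounds q-rows q≢0))
        = refl , ℕ.≤-antisym (j₁-last p≢0)
                   (m+n∸o≤n⇒m≤o j₁ j₂ b′ (j₂-last (subst (λ k → q k _ ≢ 0ℤ) (ℕ.m+n∸m≡n a c) q≢0)))
      product-at-corner : mul p q (a ℕ.+ c) (j₁ ℕ.+ j₂) ≡ p a j₁ * q c j₂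
      product-at-corner = trans (mul-single p q (ℕ.m≤m+n a c) (ℕ.m≤m+n j₁ j₂) only)
                                (cong₂ (λ k l → p a j₁ * q k l) (ℕ.m+n∸m≡n a c) (ℕ.m+n∸m≡n j₁ j₂))

  mul-boundingBox : ∀ {p q a b c d m n} → BoundingBox p a b → BoundingBox q c d →
                    SupportedIn m n (mul p q) → a ℕ.+ c ≤ m × b ℕ.+ d ≤ n
  mul-boundingBox {p} {q} {a} {b} {c} {d} p-box q-box supported
    with j , row≢0 ← mul-lastRow p-box q-box | i , column≢0 ← mul-lastRow (swap p-box) (swap q-box)
    = proj₁ (supported {a ℕ.+ c} {j} row≢0)
    , proj₂ (supported {i} {b ℕ.+ d} λ mul≡0 → column≢0 (trans (mul-transpose p q (b ℕ.+ d) i) mul≡0))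

module Arrays where

  open import Data.Integer using (ℤ; 0ℤ; +_)
  open import Data.Fin using (Fin; toℕ; fromℕ<)
  import Data.Fin.Properties as Fin
  open import Data.Vec using (Vec; []; _∷_; lookup; tabulate)
  open import Data.Vec.Properties using (lookup∘tabulate; tabulate∘lookup; tabulate-cong)
  open import Data.List using (List; []; _∷_; [_]; map; concatMap; length)
  open import Data.List.Properties using (length-++; length-map)
  open import Data.List.Membership.Propositional using (_∈_)
  open import Data.List.Membership.Propositional.Properties using (∈-map⁺; ∈-concatMap⁺)
  open import Data.List.Relation.Unary.Any as Any using (here; there)
  open import Function using (_∘_)
  open Support using (SupportedIn)

  private variable
    A B : Set
    m n : ℕ

  Array : Set → ℕ → ℕ → Set
  Array A m n = Vec (Vec A (suc n)) (suc m)

  tabulateArray : (ℕ → ℕ → A) → Array A m n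
  tabulateArray g = tabulate λ i → tabulate λ j → g (toℕ i) (toℕ j)

  toCoeffs : (A → ℤ) → Array A m n → Coeffs
  toCoeffs {m = m} {n} f a i j with i ℕ.<? suc m | j ℕ.<? suc n
  ... | yes i<1+m | yes j<1+n = f (lookup (lookup a (fromℕ< i<1+m)) (fromℕ< j<1+n))
  ... | _         | _         = 0ℤ

  Fpoly≗toCoeffs : ∀ r ε i j → Fpoly r ε i j ≡ toCoeffs signToℤ ε i j
  Fpoly≗toCoeffs r ε i j with i ℕ.<? suc r | j ℕ.<? suc r
  ... | yes _ | yes _ = refl
  ... | yes _ | no _  = refl
  ... | no _  | _     = refl

  toCoeffs-supported : ∀ (f : A → ℤ) (a : Array A m n) → SupportedIn m n (toCoeffs f a)
  toCoeffs-supported {m = m} {n} f a {i} {j} nonzero with i ℕ.<? suc m | j ℕ.<? suc n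
  ... | yes (s≤s i≤m) | yes (s≤s j≤n) = i≤m , j≤n
  ... | yes _         | no _          = contradiction refl nonzero
  ... | no _          | _             = contradiction refl nonzero

  Fpoly-supported : ∀ r ε → SupportedIn r r (Fpoly r ε)
  Fpoly-supported r ε {i} {j} F≢0 = toCoeffs-supported signToℤ ε (F≢0 ∘ trans (Fpoly≗toCoeffs r ε i j))

  toCoeffs-inside : ∀ (f : A → ℤ) (a : Array A m n) {i j} (i≤m : i ≤ m) (j≤n : j ≤ n) →
                    toCoeffs f a i j ≡ f (lookup (lookup a (fromℕ< (s≤s i≤m))) (fromℕ< (s≤s j≤n)))
  toCoeffs-inside {m = m} {n} f a {i} {j} i≤m j≤n with i ℕ.<? suc m | j ℕ.<? suc n
  ... | yes _ | yes _  = refl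
  ... | yes _ | no j≮  = contradiction (s≤s j≤n) j≮
  ... | no i≮ | _      = contradiction (s≤s i≤m) i≮

  toCoeffs-lookup : ∀ (f : A → ℤ) (a : Array A m n) i j → toCoeffs f a (toℕ i) (toℕ j) ≡ f (lookup (lookup a i) j)
  toCoeffs-lookup f a i j =
    trans (toCoeffs-inside f a (ℕ.≤-pred (Fin.toℕ<n i)) (ℕ.≤-pred (Fin.toℕ<n j)))
          (cong₂ (λ k l → f (lookup (lookup a k) l)) (Fin.fromℕ<-toℕ i _) (Fin.fromℕ<-toℕ j _))

  toCoeffs-tabulate : ∀ (f : A → ℤ) (g : ℕ → ℕ → A) {i j} → i ≤ m → j ≤ n →
                      toCoeffs f (tabulateArray {m = m} {n} g) i j ≡ f (g i j)
  toCoeffs-tabulate f g {i} {j} i≤m j≤n = trans (toCoeffs-inside f (tabulateArray g) i≤m j≤n) (cong f (begin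
    lookup (lookup (tabulateArray g) (fromℕ< (s≤s i≤m))) (fromℕ< (s≤s j≤n))
      ≡⟨ cong (λ row → lookup row (fromℕ< (s≤s j≤n))) (lookup∘tabulate (λ k → tabulate λ l → g (toℕ k) (toℕ l)) _) ⟩
    lookup (tabulate λ l → g (toℕ (fromℕ< (s≤s i≤m))) (toℕ l)) (fromℕ< (s≤s j≤n))
      ≡⟨ lookup∘tabulate (λ l → g (toℕ (fromℕ< (s≤s i≤m))) (toℕ l)) _ ⟩
    g (toℕ (fromℕ< (s≤s i≤m))) (toℕ (fromℕ< (s≤s j≤n)))
      ≡⟨ cong₂ g (Fin.toℕ-fromℕ< (s≤s i≤m)) (Fin.toℕ-fromℕ< (s≤s j≤n)) ⟩
    g i j ∎))
    where open ≡-Reasoning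

  tabulateArray-lookup : ∀ {g : ℕ → ℕ → A} (a : Array A m n) →
                         (∀ i j → g (toℕ i) (toℕ j) ≡ lookup (lookup a i) j) → tabulateArray g ≡ a
  tabulateArray-lookup a agrees =
    trans (tabulate-cong λ i → trans (tabulate-cong (agrees i)) (tabulate∘lookup (lookup a i))) (tabulate∘lookup a)

  vectorsOver : List A → (n : ℕ) → List (Vec A n)
  vectorsOver xs zero    = [ [] ]
  vectorsOver xs (suc n) = concatMap (λ v → map (_∷ v) xs) (vectorsOver xs n)

  ∈-vectorsOver : ∀ {xs : List A} → (∀ x → x ∈ xs) → (v : Vec A n) → v ∈ vectorsOver xs n
  ∈-vectorsOver complete []      = here refl
  ∈-vectorsOver complete (x ∷ v) =
    ∈-concatMap⁺ _ (Any.map (λ { refl → ∈-map⁺ (_∷ v) (complete x) }) (∈-vectorsOver complete v))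

  length-concatMap-≤ : ∀ (f : A → List B) {k} xs → (∀ {x} → x ∈ xs → length (f x) ≤ k) →
                       length (concatMap f xs) ≤ length xs ℕ.* k
  length-concatMap-≤ f []       bounded = z≤n
  length-concatMap-≤ f (x ∷ xs) bounded = ℕ.≤-trans (ℕ.≤-reflexive (length-++ (f x)))
    (ℕ.+-mono-≤ (bounded (here refl)) (length-concatMap-≤ f xs (bounded ∘ there)))

  length-vectorsOver : ∀ (xs : List A) n → length (vectorsOver xs n) ≤ length xs ^ n
  length-vectorsOver xs zero    = ℕ.≤-refl
  length-vectorsOver xs (suc n) = begin
    length (vectorsOver xs (suc n))
      ≤⟨ length-concatMap-≤ (λ v → map (_∷ v) xs) (vectorsOver xs n)
                            (λ {v} _ → ℕ.≤-reflexive (length-map (_∷ v) xs)) ⟩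
    length (vectorsOver xs n) ℕ.* length xs
      ≤⟨ ℕ.*-monoˡ-≤ (length xs) (length-vectorsOver xs n) ⟩
    length xs ^ n ℕ.* length xs
      ≡⟨ ℕ.*-comm (length xs ^ n) (length xs) ⟩
    length xs ^ suc n ∎
    where open ℕ.≤-Reasoning

  arrays : List A → (m n : ℕ) → List (Array A m n)
  arrays xs m n = vectorsOver (vectorsOver xs (suc n)) (suc m)

  ∈-arrays : ∀ {xs : List A} → (∀ x → x ∈ xs) → (a : Array A m n) → a ∈ arrays xs m n
  ∈-arrays complete = ∈-vectorsOver (∈-vectorsOver complete)

  length-arrays : ∀ (xs : List A) m n → length (arrays xs m n) ≤ length xs ^ (suc m ℕ.* suc n)
  length-arrays xs m n = begin
    length (arrays xs m n)                   ≤⟨ length-vectorsOver (vectorsOver xs (suc n)) (suc m) ⟩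
    length (vectorsOver xs (suc n)) ^ suc m  ≤⟨ ℕ.^-monoˡ-≤ (suc m) (length-vectorsOver xs (suc n)) ⟩
    (length xs ^ suc n) ^ suc m              ≡⟨ ℕ.^-*-assoc (length xs) (suc n) (suc m) ⟩
    length xs ^ (suc n ℕ.* suc m)            ≡⟨ cong (length xs ^_) (ℕ.*-comm (suc n) (suc m)) ⟩
    length xs ^ (suc m ℕ.* suc n)            ∎
    where open ℕ.≤-Reasoning

  residue : ∀ {k} → Fin k → ℤ
  residue i = + toℕ i

module Factorisation where

  open import Data.Integer using (ℤ; 0ℤ)
  open import Algebra.Properties.CommutativeSemigroup ℕ.+-commutativeSemigroup
    using () renaming (interchange to +-interchange)
  open import Function using (_∘_)
  open Product
  open Support

  record BoxedFactorisation (r : ℕ) (F : Coeffs) : Set where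
    field
      x y           : ℕ
      P Q           : Coeffs
      factorisation : ∀ i j → F i j ≡ mul P Q i j
      P-supported   : SupportedIn (r ∸ x) (r ∸ y) P
      Q-supported   : SupportedIn x y Q
      nonconstant   : 1 ≤ x ℕ.+ y
      small         : x ℕ.+ y ≤ r

  m+m≤n+n⇒m≤n : ∀ {m n} → m ℕ.+ m ≤ n ℕ.+ n → m ≤ n
  m+m≤n+n⇒m≤n {m} {n} le with m ℕ.≤? n
  ... | yes m≤n = m≤n
  ... | no  m≰n = contradiction le (ℕ.<⇒≱ (ℕ.+-mono-< (ℕ.≰⇒> m≰n) (ℕ.≰⇒> m≰n)))

  orientedFactorisation : ∀ {r F p q a b c d} → SupportedIn r r F → BoundingBox p a b → BoundingBox q c d →
                          NonConstant q → (∀ i j → F i j ≡ mul p q i j) → c ℕ.+ d ≤ a ℕ.+ b →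
                          BoxedFactorisation r F
  orientedFactorisation {r} {F} {p} {q} {a} {b} {c} {d} F-supported p-box q-box q-nc F≗pq c+d≤a+b = record
    { x = c ; y = d ; P = p ; Q = q ; factorisation = F≗pq
    ; P-supported = λ p≢0 → ℕ.≤-trans (proj₁ (boundingBox-supported p-box p≢0)) (ℕ.m+n≤o⇒m≤o∸n a a+c≤r)
                          , ℕ.≤-trans (proj₂ (boundingBox-supported p-box p≢0)) (ℕ.m+n≤o⇒m≤o∸n b b+d≤r)
    ; Q-supported = boundingBox-supported q-box
    ; nonconstant = boundingBox-nonConstant q-box q-nc
    ; small = m+m≤n+n⇒m≤n (begin
        (c ℕ.+ d) ℕ.+ (c ℕ.+ d) ≤⟨ ℕ.+-monoˡ-≤ (c ℕ.+ d) c+d≤a+b ⟩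
        (a ℕ.+ b) ℕ.+ (c ℕ.+ d) ≡⟨ +-interchange a b c d ⟩
        (a ℕ.+ c) ℕ.+ (b ℕ.+ d) ≤⟨ ℕ.+-mono-≤ a+c≤r b+d≤r ⟩
        r ℕ.+ r                 ∎) }
    where
    open ℕ.≤-Reasoning
    pq-supported : SupportedIn r r (mul p q)
    pq-supported {i} {j} pq≢0 = F-supported (pq≢0 ∘ trans (sym (F≗pq i j)))
    a+c≤r : a ℕ.+ c ≤ r
    a+c≤r = proj₁ (mul-boundingBox p-box q-box pq-supported)
    b+d≤r : b ℕ.+ d ≤ r
    b+d≤r = proj₂ (mul-boundingBox p-box q-box pq-supported)

  boxedFactorisation : ∀ {r F} → SupportedIn r r F → Reducible F → BoxedFactorisation r F
  boxedFactorisation F-supported (p , q , p-fin , q-fin , p-nc@(_ , _ , _ , p≢0) , q-nc@(_ , _ , _ , q≢0) , F≗pq)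
    with a , b , p-box ← boundingBox p-fin p≢0 | c , d , q-box ← boundingBox q-fin q≢0
    with c ℕ.+ d ℕ.≤? a ℕ.+ b
  ... | yes c+d≤a+b = orientedFactorisation F-supported p-box q-box q-nc F≗pq c+d≤a+b
  ... | no  c+d≰a+b = orientedFactorisation F-supported q-box p-box p-nc
                        (λ i j → trans (F≗pq i j) (mul-comm p q i j)) (ℕ.<⇒≤ (ℕ.≰⇒> c+d≰a+b))

module Encoding where

  open import Data.Integer using (ℤ; +_; 0ℤ; 1ℤ; -1ℤ; _+_; _*_; _-_)
  import Data.Integer.Properties as ℤ
  open import Data.Integer.DivMod using (n%ℕd<d)
  open import Data.Integer.Divisibility.Signed using (_∣_; divides)
  open import Data.Integer.Tactic.RingSolver using (solve-∀)
  import Data.Nat.Divisibility as ℕ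
  open import Data.Fin using (Fin; zero; toℕ; fromℕ<)
  import Data.Fin.Properties as Fin
  open import Data.Vec using (replicate; lookup)
  open import Data.Sign using (Sign)
  open import Data.List using (allFin)
  open import Data.List.Membership.Propositional using (lose)
  open import Data.List.Membership.Propositional.Properties using (∈-allFin)
  open import Data.List.Relation.Unary.Any as Any using (any?)
  open import Data.List.Relation.Unary.Any.Properties using (lookup-result)
  open import Relation.Nullary using (Dec)
  open import Relation.Nullary.Decidable using (toWitnessFalse; _×-dec_)
  open Congruence
  open Product
  open Support
  open Arrays
  open Factorisation

  private variable
    m n : ℕ

  extend-mod : ∀ {k} {p q : Coeffs} →
               (∀ {i j} → ¬ (i ≤ m × j ≤ n) → p i j ≡ 0ℤ) → (∀ {i j} → ¬ (i ≤ m × j ≤ n) → q i j ≡ 0ℤ) →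
               (∀ {i j} → i ≤ m → j ≤ n → p i j ≡ q i j [mod k ]) → ∀ i j → p i j ≡ q i j [mod k ]
  extend-mod {m} {n} p-vanishes q-vanishes inside i j with (i ℕ.≤? m) ×-dec (j ℕ.≤? n)
  ... | yes (i≤m , j≤n) = inside i≤m j≤n
  ... | no  outside     = mod-reflexive (trans (p-vanishes outside) (sym (q-vanishes outside)))

  reduceMod : ∀ k .{{_ : ℕ.NonZero k}} → Coeffs → Array (Fin k) m n
  reduceMod k p = tabulateArray λ i j → fromℕ< (n%ℕd<d (p i j) k)

  reduceMod-inside : ∀ k .{{_ : ℕ.NonZero k}} p {i j} → i ≤ m → j ≤ n →
                     toCoeffs residue (reduceMod {m} {n} k p) i j ≡ p i j [mod k ]
  reduceMod-inside k p {i} {j} i≤m j≤n =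
    mod-trans (mod-reflexive (trans (toCoeffs-tabulate residue (λ i j → fromℕ< (n%ℕd<d (p i j) k)) i≤m j≤n)
                                    (cong +_ (Fin.toℕ-fromℕ< (n%ℕd<d (p i j) k)))))
              (%ℕ-mod (p i j))

  reduceMod-≡ : ∀ k .{{_ : ℕ.NonZero k}} {p} → SupportedIn m n p →
                ∀ i j → toCoeffs residue (reduceMod {m} {n} k p) i j ≡ p i j [mod k ]
  reduceMod-≡ {m} {n} k {p} p-supported =
    extend-mod {p = toCoeffs residue (reduceMod {m} {n} k p)} {q = p}
      (vanishes-outside (toCoeffs-supported residue _)) (vanishes-outside p-supported) (reduceMod-inside k p)

  signToℤ-odd : ∀ s → signToℤ s ≡ 1ℤ [mod 2 ]
  signToℤ-odd Sign.+ = mod-refl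
  signToℤ-odd Sign.- = congruent (divides -1ℤ refl)

  signMod4 : ℤ → Sign
  signMod4 z with z ≡? 1ℤ [mod 4 ]
  ... | yes _ = Sign.+
  ... | no  _ = Sign.-

  signMod4-signToℤ : ∀ {z} s → z ≡ signToℤ s [mod 4 ] → signMod4 z ≡ s
  signMod4-signToℤ {z} Sign.+ z≡1 with z ≡? 1ℤ [mod 4 ]
  ... | yes _   = refl
  ... | no  z≢1 = contradiction z≡1 z≢1
  signMod4-signToℤ {z} Sign.- z≡-1 with z ≡? 1ℤ [mod 4 ]
  ... | no  _   = refl
  ... | yes z≡1 = contradiction (mod-trans (mod-sym z≡-1) z≡1) (toWitnessFalse {a? = -1ℤ ≡? 1ℤ [mod 4 ]} _)

  OddProductOn : ℕ → ℕ → Coeffs → Coeffs → Set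
  OddProductOn m n p q = ∀ {i} → i < suc m → ∀ {j} → j < suc n → mul p q i j ≡ 1ℤ [mod 2 ]

  oddProductOn? : ∀ m n p q → Dec (OddProductOn m n p q)
  oddProductOn? m n p q = ℕ.allUpTo? (λ i → ℕ.allUpTo? (λ j → mul p q i j ≡? 1ℤ [mod 2 ]) (suc n)) (suc m)

  -- Some 0/1 array whose product with q is odd on the box (junk if there is none); when q 0 0 is odd,
  -- such an array is unique by mul-cancelʳ-mod.
  parityCofactor : Coeffs → (m n : ℕ) → Array (Fin 2) m n
  parityCofactor q m n with any? (λ c → oddProductOn? m n (toCoeffs residue c) q) (arrays (allFin 2) m n)
  ... | yes found = Any.lookup found
  ... | no  _     = replicate _ (replicate _ zero)

  parityCofactor-odd : ∀ q (c : Array (Fin 2) m n) → OddProductOn m n (toCoeffs residue c) q →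
                       OddProductOn m n (toCoeffs residue (parityCofactor q m n)) q
  parityCofactor-odd {m} {n} q c odd
    with any? (λ c → oddProductOn? m n (toCoeffs residue c) q) (arrays (allFin 2) m n)
  ... | yes found = lookup-result found
  ... | no  none  = contradiction (lose (∈-arrays ∈-allFin c) (λ {i} → odd {i})) none

  addHighBit : Coeffs → Coeffs → Coeffs
  addHighBit s h i j = s i j + + 2 * h i j

  decodedFactor : (r x y : ℕ) → Array (Fin 4) x y → Array (Fin 2) (r ∸ x) (r ∸ y) → Coeffs
  decodedFactor r x y qc hc =
    addHighBit (toCoeffs residue (parityCofactor (toCoeffs residue qc) (r ∸ x) (r ∸ y))) (toCoeffs residue hc)

  decode : (r x y : ℕ) → Array (Fin 4) x y → Array (Fin 2) (r ∸ x) (r ∸ y) → SignMat r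
  decode r x y qc hc =
    tabulateArray λ i j → signMod4 (mul (decodedFactor r x y qc hc) (toCoeffs residue qc) i j)

  module _ {r} {ε : SignMat r} (bf : BoxedFactorisation r (Fpoly r ε)) where

    open BoxedFactorisation bf

    private
      F-odd : ∀ {i j} → i ≤ r → j ≤ r → Fpoly r ε i j ≡ 1ℤ [mod 2 ]
      F-odd {i} {j} i≤r j≤r =
        mod-trans (mod-reflexive (trans (Fpoly≗toCoeffs r ε i j) (toCoeffs-inside signToℤ ε i≤r j≤r)))
                  (signToℤ-odd _)

      qc : Array (Fin 4) x y
      qc = reduceMod 4 Q

      Q₄ : Coeffs
      Q₄ = toCoeffs residue qc

      Q₄≡Q : ∀ i j → Q₄ i j ≡ Q i j [mod 4 ]
      Q₄≡Q = reduceMod-≡ 4 Q-supported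

      Q₄≡Q-mod2 : ∀ i j → Q₄ i j ≡ Q i j [mod 2 ]
      Q₄≡Q-mod2 i j = mod-∣ (ℕ.divides 2 refl) (Q₄≡Q i j)

      P-odd : OddProductOn (r ∸ x) (r ∸ y) P Q₄
      P-odd {i} (s≤s i≤) {j} (s≤s j≤) =
        mod-trans (mul-cong-mod {p = P} (λ _ _ → mod-refl) Q₄≡Q-mod2 i j)
                  (mod-trans (mod-reflexive (sym (factorisation i j)))
                             (F-odd (ℕ.≤-trans i≤ (ℕ.m∸n≤m r x)) (ℕ.≤-trans j≤ (ℕ.m∸n≤m r y))))

      S : Coeffs
      S = toCoeffs residue (parityCofactor Q₄ (r ∸ x) (r ∸ y))

      S-odd : OddProductOn (r ∸ x) (r ∸ y) S Q₄
      S-odd = parityCofactor-odd Q₄ (reduceMod 2 P) λ {i} i< {j} j< →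
        mod-trans (mul-cong-mod {q = Q₄} (reduceMod-≡ 2 P-supported) (λ _ _ → mod-refl) i j) (P-odd i< j<)

      Q₄-unit : Q₄ 0 0 * P 0 0 ≡ 1ℤ [mod 2 ]
      Q₄-unit = mod-trans (*-cong-mod (Q₄≡Q-mod2 0 0) mod-refl)
                  (mod-trans (mod-reflexive (trans (ℤ.*-comm (Q 0 0) (P 0 0))
                                                   (trans (sym (mul-origin P Q)) (sym (factorisation 0 0)))))
                             (F-odd z≤n z≤n))

      S≡P : ∀ i j → S i j ≡ P i j [mod 2 ]
      S≡P = extend-mod {p = S} {q = P}
              (vanishes-outside (toCoeffs-supported residue _)) (vanishes-outside P-supported)
              (mul-cancelʳ-mod {p = S} {p′ = P} {q = Q₄} Q₄-unit λ i≤ j≤ →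
                 mod-trans (S-odd (s≤s i≤) (s≤s j≤)) (mod-sym (P-odd (s≤s i≤) (s≤s j≤))))

      half : Coeffs
      half i j = _∣_.quotient (_≡_[mod_].divides-difference (mod-sym (S≡P i j)))

      P≡S+2half : ∀ i j → P i j ≡ S i j + + 2 * half i j
      P≡S+2half i j = begin
        P i j                      ≡⟨ add-difference (P i j) (S i j) ⟩
        S i j + (P i j - S i j)    ≡⟨ cong (_+_ (S i j)) (_∣_.equality 2∣P-S) ⟩
        S i j + half i j * + 2     ≡⟨ cong (_+_ (S i j)) (ℤ.*-comm (half i j) (+ 2)) ⟩
        S i j + + 2 * half i j     ∎
        where
        open ≡-Reasoning
        2∣P-S = _≡_[mod_].divides-difference (mod-sym (S≡P i j))
        add-difference : ∀ p s → p ≡ s + (p - s)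
        add-difference = solve-∀

      hc : Array (Fin 2) (r ∸ x) (r ∸ y)
      hc = reduceMod 2 half

      decodedFactor≡P : ∀ i j → decodedFactor r x y qc hc i j ≡ P i j [mod 4 ]
      decodedFactor≡P = extend-mod {p = decodedFactor r x y qc hc} {q = P}
        (λ outside → cong₂ (λ s h → s + + 2 * h) (vanishes-outside (toCoeffs-supported residue _) outside)
                                                  (vanishes-outside (toCoeffs-supported residue _) outside))
        (vanishes-outside P-supported)
        (λ {i} {j} i≤ j≤ →
           mod-trans (+-cong-mod (mod-refl {a = S i j}) (*-scale-mod 2 (reduceMod-inside 2 half i≤ j≤)))
                     (mod-reflexive (sym (P≡S+2half i j))))

      decoded≡F : ∀ i j → mul (decodedFactor r x y qc hc) Q₄ i j ≡ Fpoly r ε i j [mod 4 ]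
      decoded≡F i j = mod-trans (mul-cong-mod {p = decodedFactor r x y qc hc} {q = Q₄} decodedFactor≡P Q₄≡Q i j)
                                (mod-reflexive (sym (factorisation i j)))

    encode : ∃₂ λ (qc : Array (Fin 4) x y) (hc : Array (Fin 2) (r ∸ x) (r ∸ y)) → decode r x y qc hc ≡ ε
    encode = qc , hc ,
      tabulateArray-lookup {g = λ i j → signMod4 (mul (decodedFactor r x y qc hc) (toCoeffs residue qc) i j)} ε
        λ i j → signMod4-signToℤ {z = mul (decodedFactor r x y qc hc) (toCoeffs residue qc) (toℕ i) (toℕ j)}
          (lookup (lookup ε i) j)
          (mod-trans (decoded≡F (toℕ i) (toℕ j))
                     (mod-reflexive (trans (Fpoly≗toCoeffs r ε (toℕ i) (toℕ j)) (toCoeffs-lookup signToℤ ε i j))))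

module Estimates where

  open import Data.Nat using (_+_; _*_; _^_)
  open import Data.Nat.Properties
  open import Data.Nat.DivMod using (_/_; _%_; m/n*n≤m; m≡m%n+[m/n]*n; m%n<n; m*n/n≡m; /-monoˡ-≤)
  open import Data.Nat.Tactic.RingSolver using (solve-∀)
  open ≤-Reasoning

  private
    4xy≤[x+y]²-ordered : ∀ {x y} → x ≤ y → 4 * (x * y) ≤ (x + y) * (x + y)
    4xy≤[x+y]²-ordered {x} x≤y with d , refl ← m≤n⇒∃[o]m+o≡n x≤y = begin
      4 * (x * (x + d))               ≤⟨ m≤m+n _ (d * d) ⟩
      4 * (x * (x + d)) + d * d       ≡⟨ square x d ⟩
      (x + (x + d)) * (x + (x + d))   ∎
      where square : ∀ x d → 4 * (x * (x + d)) + d * d ≡ (x + (x + d)) * (x + (x + d))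
            square = solve-∀

  4xy≤[x+y]² : ∀ x y → 4 * (x * y) ≤ (x + y) * (x + y)
  4xy≤[x+y]² x y with ≤-total x y
  ... | inj₁ x≤y = 4xy≤[x+y]²-ordered x≤y
  ... | inj₂ y≤x = subst₂ (λ a b → 4 * a ≤ b * b) (*-comm y x) (+-comm y x) (4xy≤[x+y]²-ordered y≤x)

  5n≤n²+6 : ∀ n → 5 * n ≤ n * n + 6
  5n≤n²+6 0 = z≤n
  5n≤n²+6 1 = m≤m+n 5 2
  5n≤n²+6 2 = ≤-refl
  5n≤n²+6 (suc (suc (suc k))) = begin
    5 * (3 + k)                     ≤⟨ m≤m+n _ (k + k * k) ⟩
    5 * (3 + k) + (k + k * k)       ≡⟨ square k ⟩
    (3 + k) * (3 + k) + 6           ∎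
    where square : ∀ k → 5 * (3 + k) + (k + k * k) ≡ (3 + k) * (3 + k) + 6
          square = solve-∀

  private
    x+y+w∸x≡y+w : ∀ x y w → x + y + w ∸ x ≡ y + w
    x+y+w∸x≡y+w x y w = trans (cong (_∸ x) (+-assoc x y w)) (m+n∸m≡n x (y + w))

    x+y+w∸y≡x+w : ∀ x y w → x + y + w ∸ y ≡ x + w
    x+y+w∸y≡x+w x y w = trans (cong (λ s → s + w ∸ y) (+-comm x y)) (x+y+w∸x≡y+w y x w)

  -- The left-hand exponent counts the bits of a code (Q mod 4 on [0,x]×[0,y], one bit of P mod 4 on the
  -- complementary box); four times its distance to (r + 1)² is at least r − 14.
  code-gap : ∀ {r x y h} → 1 ≤ x + y → x + y ≤ r → 4 * h + 14 ≤ r →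
             2 * (suc x * suc y) + suc (r ∸ x) * suc (r ∸ y) + h ≤ suc r * suc r
  code-gap {r} {x} {y} {h} 1≤x+y x+y≤r 4h+14≤r with w , refl ← m≤n⇒∃[o]m+o≡n x+y≤r
    rewrite x+y+w∸x≡y+w x y w | x+y+w∸y≡x+w x y w =
    *-cancelˡ-≤ 4 (+-cancelʳ-≤ slack (4 * (E + h)) (4 * (R * R)) (begin
      4 * (E + h) + slack
        ≡⟨ balance x y w h ⟩
      4 * (R * R) + (4 * h + 14) + (3 * (4 * (x * y)) + 5 * s + w)
        ≤⟨ +-mono-≤ (+-monoʳ-≤ (4 * (R * R)) 4h+14≤r)
                    (+-mono-≤ (+-mono-≤ (*-monoʳ-≤ 3 (4xy≤[x+y]² x y)) (5n≤n²+6 s)) w≤4ws) ⟩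
      4 * (R * R) + (s + w) + (3 * (s * s) + (s * s + 6) + 4 * w * s)
        ≡⟨ +-assoc (4 * (R * R)) (s + w) _ ⟩
      4 * (R * R) + slack ∎))
    where
    s = x + y
    R = suc (s + w)
    E = 2 * (suc x * suc y) + suc (y + w) * suc (x + w)
    slack = (s + w) + (3 * (s * s) + (s * s + 6) + 4 * w * s)
    balance : ∀ x y w h →
      4 * (2 * (suc x * suc y) + suc (y + w) * suc (x + w) + h)
        + ((x + y + w) + (3 * ((x + y) * (x + y)) + ((x + y) * (x + y) + 6) + 4 * w * (x + y)))
      ≡ 4 * (suc (x + y + w) * suc (x + y + w)) + (4 * h + 14) + (3 * (4 * (x * y)) + 5 * (x + y) + w)
    balance = solve-∀
    w≤4ws : w ≤ 4 * w * s
    w≤4ws = begin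
      w          ≡⟨ *-identityʳ w ⟨
      w * 1      ≤⟨ *-monoʳ-≤ w 1≤x+y ⟩
      w * s      ≤⟨ *-monoˡ-≤ s (m≤n*m w 4) ⟩
      4 * w * s  ∎

  cube-doubling : ∀ {m} → 4 ≤ m → suc m * suc m * suc m ≤ 2 * (m * m * m)
  cube-doubling 4≤m with u , refl ← m≤n⇒∃[o]m+o≡n 4≤m = begin
    (5 + u) * (5 + u) * (5 + u)                                          ≤⟨ m≤m+n _ _ ⟩
    (5 + u) * (5 + u) * (5 + u) + (u * u * u + 9 * (u * u) + 21 * u + 3) ≡⟨ cubes u ⟩
    2 * ((4 + u) * (4 + u) * (4 + u))                                    ∎
    where cubes : ∀ u → (5 + u) * (5 + u) * (5 + u) + (u * u * u + 9 * (u * u) + 21 * u + 3)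
                        ≡ 2 * ((4 + u) * (4 + u) * (4 + u))
          cubes = solve-∀

  25m³≤2^m : ∀ {m} → 17 ≤ m → 25 * (m * m * m) ≤ 2 ^ m
  25m³≤2^m {suc k} 17≤1+k with 17 ≤? k
  ... | no 17≰k with refl ← ≤-antisym 17≤1+k (≰⇒> 17≰k) = m≤m+n 122825 8247
  ... | yes 17≤k = begin
    25 * (suc k * suc k * suc k)  ≤⟨ *-monoʳ-≤ 25 (cube-doubling (≤-trans (m≤m+n 4 13) 17≤k)) ⟩
    25 * (2 * (k * k * k))        ≡⟨ swap-factors (k * k * k) ⟩
    2 * (25 * (k * k * k))        ≤⟨ *-monoʳ-≤ 2 (25m³≤2^m 17≤k) ⟩
    2 * 2 ^ k                     ∎
    where swap-factors : ∀ c → 25 * (2 * c) ≡ 2 * (25 * c)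
          swap-factors = solve-∀

  threshold : ∀ n r → 4 * (18 + n) + 14 ≤ r → ∃[ h ] 4 * h + 14 ≤ r × suc r * suc r * suc n ≤ 2 ^ h
  threshold n r bound = h , 4h+14≤r , (begin
    suc r * suc r * suc n          ≤⟨ *-mono-≤ (*-mono-≤ 1+r≤5h 1+r≤5h) 1+n≤h ⟩
    5 * h * (5 * h) * h            ≡⟨ cube h ⟩
    25 * (h * h * h)               ≤⟨ 25m³≤2^m (≤-trans (m≤m+n 17 (suc n)) 18+n≤h) ⟩
    2 ^ h                          ∎)
    where
    h = (r ∸ 14) / 4
    14≤r : 14 ≤ r
    14≤r = ≤-trans (m≤n+m 14 (4 * (18 + n))) bound
    split : r ∸ 14 ≡ (r ∸ 14) % 4 + h * 4
    split = m≡m%n+[m/n]*n (r ∸ 14) 4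
    4h+14≤r : 4 * h + 14 ≤ r
    4h+14≤r = begin
      4 * h + 14        ≡⟨ cong (_+ 14) (*-comm 4 h) ⟩
      h * 4 + 14        ≤⟨ +-monoˡ-≤ 14 (m/n*n≤m (r ∸ 14) 4) ⟩
      r ∸ 14 + 14       ≡⟨ m∸n+n≡m 14≤r ⟩
      r                 ∎
    1+r≤4h+18 : suc r ≤ 4 * h + 18
    1+r≤4h+18 = begin
      suc r                                   ≡⟨ cong suc (m∸n+n≡m 14≤r) ⟨
      suc (r ∸ 14 + 14)                       ≡⟨ cong (λ k → suc (k + 14)) split ⟩
      suc ((r ∸ 14) % 4 + h * 4 + 14)         ≤⟨ +-monoˡ-≤ 14 (+-monoˡ-≤ (h * 4) (m%n<n (r ∸ 14) 4)) ⟩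
      4 + h * 4 + 14                          ≡⟨ regroup h ⟩
      4 * h + 18                              ∎
      where regroup : ∀ h → 4 + h * 4 + 14 ≡ 4 * h + 18
            regroup = solve-∀
    18+n≤h : 18 + n ≤ h
    18+n≤h = begin
      18 + n                  ≡⟨ m*n/n≡m (18 + n) 4 ⟨
      (18 + n) * 4 / 4        ≤⟨ /-monoˡ-≤ 4 (subst (_≤ r ∸ 14) (*-comm 4 (18 + n)) (m+n≤o⇒m≤o∸n _ bound)) ⟩
      h                       ∎
    1+n≤h : suc n ≤ h
    1+n≤h = ≤-trans (s≤s (m≤n+m n 17)) 18+n≤h
    1+r≤5h : suc r ≤ 5 * h
    1+r≤5h = begin
      suc r           ≤⟨ 1+r≤4h+18 ⟩
      4 * h + 18      ≤⟨ +-monoʳ-≤ (4 * h) (≤-trans (m≤m+n 18 n) 18+n≤h) ⟩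
      4 * h + h       ≡⟨ five h ⟩
      5 * h           ∎
      where five : ∀ h → 4 * h + h ≡ 5 * h
            five = solve-∀
    cube : ∀ h → 5 * h * (5 * h) * h ≡ 25 * (h * h * h)
    cube = solve-∀

module Counting where

  open import Data.Nat using (_+_; _*_; _^_)
  open import Data.Nat.Properties
  open import Algebra.Properties.CommutativeSemigroup *-commutativeSemigroup using (xy∙z≈xz∙y)
  open import Data.Fin using (Fin)
  open import Data.List using (List; map; concatMap; filter; upTo; allFin; length)
  open import Data.List.Properties using (length-map; length-filter; length-upTo)
  open import Data.List.Membership.Propositional using (_∈_; lose)
  open import Data.List.Membership.Propositional.Properties
    using (∈-map⁺; ∈-concatMap⁺; ∈-filter⁺; ∈-filter⁻; ∈-upTo⁺; ∈-allFin)
  open import Relation.Nullary.Decidable using (_×-dec_)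
  open import Relation.Unary using (Decidable)
  open Arrays
  open Factorisation
  open Encoding
  open Estimates
  open ≤-Reasoning

  Admissible : ℕ → ℕ × ℕ → Set
  Admissible r (x , y) = 1 ≤ x + y × x + y ≤ r

  admissible? : ∀ r → Decidable (Admissible r)
  admissible? r (x , y) = (1 ℕ.≤? x + y) ×-dec (x + y ℕ.≤? r)

  grid : ℕ → List (ℕ × ℕ)
  grid r = concatMap (λ x → map (x ,_) (upTo (suc r))) (upTo (suc r))

  decodings : (r : ℕ) → ℕ × ℕ → List (SignMat r)
  decodings r (x , y) =
    concatMap (λ qc → map (decode r x y qc) (arrays (allFin 2) (r ∸ x) (r ∸ y))) (arrays (allFin 4) x y)

  candidates : (r : ℕ) → List (SignMat r)
  candidates r = concatMap (decodings r) (filter (admissible? r) (grid r))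

  ∈-grid : ∀ {r x y} → x ≤ r → y ≤ r → (x , y) ∈ grid r
  ∈-grid {r} {x} x≤r y≤r =
    ∈-concatMap⁺ (λ x → map (x ,_) (upTo (suc r))) (lose (∈-upTo⁺ (s≤s x≤r)) (∈-map⁺ (x ,_) (∈-upTo⁺ (s≤s y≤r))))

  boxed∈candidates : ∀ {r ε} → BoxedFactorisation r (Fpoly r ε) → ε ∈ candidates r
  boxed∈candidates {r} {ε} boxed =
    ∈-concatMap⁺ (decodings r) (lose (∈-filter⁺ (admissible? r) xy∈grid (nonconstant , small)) ε∈decodings)
    where
    open BoxedFactorisation boxed
    xy∈grid : (x , y) ∈ grid r
    xy∈grid = ∈-grid (m+n≤o⇒m≤o x small) (m+n≤o⇒n≤o x small)
    decodings-with : Array (Fin 4) x y → List (SignMat r)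
    decodings-with qc = map (decode r x y qc) (arrays (allFin 2) (r ∸ x) (r ∸ y))
    ε∈decodings : ε ∈ decodings r (x , y)
    ε∈decodings = let (qc , hc , decoded) = encode boxed in
      subst (_∈ decodings r (x , y)) decoded
        (∈-concatMap⁺ decodings-with
          (lose (∈-arrays ∈-allFin qc) (∈-map⁺ (decode r x y qc) (∈-arrays ∈-allFin hc))))

  reducible∈candidates : ∀ r ε → Reducible (Fpoly r ε) → ε ∈ candidates r
  reducible∈candidates r ε reducible = boxed∈candidates (boxedFactorisation (Fpoly-supported r ε) reducible)

  length-grid : ∀ r → length (grid r) ≤ suc r * suc r
  length-grid r = begin
    length (grid r)
      ≤⟨ length-concatMap-≤ (λ x → map (x ,_) (upTo (suc r))) (upTo (suc r)) (λ {x} _ →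
           ≤-reflexive (trans (length-map (x ,_) (upTo (suc r))) (length-upTo (suc r)))) ⟩
    length (upTo (suc r)) * suc r
      ≡⟨ cong (_* suc r) (length-upTo (suc r)) ⟩
    suc r * suc r ∎

  length-decodings : ∀ r x y →
                     length (decodings r (x , y)) ≤ 2 ^ (2 * (suc x * suc y) + suc (r ∸ x) * suc (r ∸ y))
  length-decodings r x y = begin
    length (decodings r (x , y))
      ≤⟨ length-concatMap-≤ (λ qc → map (decode r x y qc) high-bits) (arrays (allFin 4) x y) (λ {qc} _ →
           ≤-trans (≤-reflexive (length-map (decode r x y qc) high-bits))
                   (length-arrays (allFin 2) (r ∸ x) (r ∸ y))) ⟩
    length (arrays (allFin 4) x y) * 2 ^ B
      ≤⟨ *-monoˡ-≤ (2 ^ B) (length-arrays (allFin 4) x y) ⟩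
    (2 ^ 2) ^ A * 2 ^ B
      ≡⟨ cong (_* 2 ^ B) (^-*-assoc 2 2 A) ⟩
    2 ^ (2 * A) * 2 ^ B
      ≡⟨ ^-distribˡ-+-* 2 (2 * A) B ⟨
    2 ^ (2 * A + B) ∎
    where
    high-bits = arrays (allFin 2) (r ∸ x) (r ∸ y)
    A = suc x * suc y
    B = suc (r ∸ x) * suc (r ∸ y)

  length-candidates-≤ : ∀ {r h} → 4 * h + 14 ≤ r →
                        length (candidates r) ≤ suc r * suc r * 2 ^ (suc r * suc r ∸ h)
  length-candidates-≤ {r} {h} 4h+14≤r = begin
    length (candidates r)
      ≤⟨ length-concatMap-≤ (decodings r) (filter (admissible? r) (grid r)) decodings-short ⟩
    length (filter (admissible? r) (grid r)) * 2 ^ (S ∸ h)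
      ≤⟨ *-monoˡ-≤ (2 ^ (S ∸ h)) (≤-trans (length-filter (admissible? r) (grid r)) (length-grid r)) ⟩
    S * 2 ^ (S ∸ h) ∎
    where
    S = suc r * suc r
    decodings-short : ∀ {xy} → xy ∈ filter (admissible? r) (grid r) → length (decodings r xy) ≤ 2 ^ (S ∸ h)
    decodings-short {x , y} xy∈ = let (_ , 1≤x+y , x+y≤r) = ∈-filter⁻ (admissible? r) {xs = grid r} xy∈ in
      ≤-trans (length-decodings r x y) (^-monoʳ-≤ 2 (m+n≤o⇒m≤o∸n (2 * (suc x * suc y) + suc (r ∸ x) * suc (r ∸ y))
                                                               (code-gap {r} {x} {y} {h} 1≤x+y x+y≤r 4h+14≤r)))

  length-candidates : ∀ n r → 4 * (18 + n) + 14 ≤ r → length (candidates r) * suc n ≤ 2 ^ (suc r * suc r)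
  length-candidates n r large = from-threshold (threshold n r large)
    where
    S = suc r * suc r
    from-threshold : ∃[ h ] 4 * h + 14 ≤ r × S * suc n ≤ 2 ^ h → length (candidates r) * suc n ≤ 2 ^ S
    from-threshold (h , 4h+14≤r , polynomial≤2^h) = begin
      length (candidates r) * suc n     ≤⟨ *-monoˡ-≤ (suc n) (length-candidates-≤ {r} {h} 4h+14≤r) ⟩
      S * 2 ^ (S ∸ h) * suc n           ≡⟨ xy∙z≈xz∙y S (2 ^ (S ∸ h)) (suc n) ⟩
      S * suc n * 2 ^ (S ∸ h)           ≤⟨ *-monoˡ-≤ (2 ^ (S ∸ h)) polynomial≤2^h ⟩
      2 ^ h * 2 ^ (S ∸ h)               ≡⟨ ^-distribˡ-+-* 2 h (S ∸ h) ⟨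
      2 ^ (h + (S ∸ h))                 ≡⟨ cong (2 ^_) (m+[n∸m]≡n h≤S) ⟩
      2 ^ S                             ∎
      where
      h≤S : h ≤ S
      h≤S = ≤-trans (m≤n*m h 4) (≤-trans (m+n≤o⇒m≤o (4 * h) 4h+14≤r) (≤-trans (n≤1+n r) (m≤m*n (suc r) (suc r))))

open import Data.Nat using (ℕ; suc; _*_; _^_; _≤_)
open import Data.List using (List; length)
open import Data.List.Membership.Propositional using (_∈_)
open import Data.Product using (∃; ∃-syntax; _×_)

mainTheorem1 : ∀ (n : ℕ) → ∃[ R ] (∀ (r : ℕ) → R ≤ r →
                 ∃[ L ] (length {A = SignMat r} L * suc n ≤ 2 ^ (suc r * suc r)
                   × (∀ (ε : SignMat r) → Reducible (Fpoly r ε) → ε ∈ L)))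
mainTheorem1 n = 4 * (18 ℕ.+ n) ℕ.+ 14 , λ r large →
  Counting.candidates r , Counting.length-candidates n r large , Counting.reducible∈candidates r
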